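{- Let $\alpha,n\in\mathbb{Z}^+$ and $(A,B)\in\mathcal{T}(\alpha,[n])$, and suppose $A$ has $j$ rifts $r_1,\dots,r_j$ (in increasing order). Then $|r_1|\le|r_i|$ for all $i\in[1,j]$.
   Context: $[n]=\{1,\dots,n\}$. $A+B$ is the Minkowski sum. $\mathcal{T}(\alpha,C)$ is the set of pairs $(A,B)$ of finite subsets of $\mathbb{Z}$ with $A+B=C$, $|C|=|A||B|$, $|A|=\alpha$, $0\in B$, $\min B\ge0$. For $(A,B)\in\mathcal{T}(\alpha,[n])$ (so $A\subseteq[n]$ and $1\in A$), the segments $s_1,s_2,\dots,s_{t}$ of $A$ are the maximal runs of consecutive integers contained in $A$, in increasing order, and the rifts are $r_i=\{x\in\mathbb{Z}:\max s_i<x<\min s_{i+1}\}$ for $i=1,\dots,t-1$ (the elements of $[n]$ strictly between consecutive segments). -}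

module Defs where

open import Data.Nat using (ℕ)
open import Data.Integer using (ℤ; +_; _+_; _-_; _≤_; _<_; ∣_∣; 1ℤ; 0ℤ)
open import Data.List using (List; length)
open import Data.List.Membership.Propositional using (_∈_; _∉_)
open import Data.List.Relation.Unary.Unique.Propositional using (Unique)
open import Data.Product using (_×_; ∃-syntax)
open import Relation.Binary.PropositionalEquality using (_≡_)
open import Relation.Nullary using (¬_)
open import Function.Bundles using (_⇔_)

-- Finite subsets of ℤ are represented by duplicate-free lists; |X| = length X.

InInterval : ℕ → ℤ → Set
InInterval n z = (1ℤ ≤ z) × (z ≤ + n)

InT : ℕ → ℕ → List ℤ → List ℤ → Set
InT α n A B =
  Unique A × Unique B ×
  (∀ z → InInterval n z ⇔ (∃[ a ] ∃[ b ] (a ∈ A × b ∈ B × a + b ≡ z))) ×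
  (n ≡ length A Data.Nat.* length B) ×
  (length A ≡ α) ×
  (0ℤ ∈ B) ×
  (∀ b → b ∈ B → 0ℤ ≤ b)

-- A rift of A: the set {z : x < z < y}, where x = max sᵢ and y = min sᵢ₊₁ for
-- consecutive segments sᵢ, sᵢ₊₁ of A.
-- We identify the rift with the pair (x, y).
Rift : List ℤ → ℤ → ℤ → Set
Rift A x y =
  x ∈ A × y ∈ A × x < y × (x + 1ℤ) ∉ A ×
  (∀ z → z ∈ A → ¬ ((x < z) × (z < y)))

riftSize : ℤ → ℤ → ℕ
riftSize x y = ∣ y - x - 1ℤ ∣

FirstRift : List ℤ → ℤ → ℤ → Set
FirstRift A x y = Rift A x y × (∀ x' y' → Rift A x' y' → x ≤ x')

-- Since |C| = |A||B|, every c ∈ [n] is a + b in exactly one way. Let s₁ = [1, m] be the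
-- first segment. Then m ∈ B, every element of B is a multiple of m, and A is a union of blocks
-- [km + 1, km + m] (the structure of tilings of an interval). So a rift (x, y) other than
-- r₁ = (m, m + G + 1) has m ∣ x and its length D is a multiple of m. If D < G, then m + D + 1
-- lies in r₁, which forces m + D ∈ B; adding it to the first element x − m + 1 of the block
-- ending at x gives y ∈ A, contradicting the uniqueness of the representation y = y + 0.
module Submission where

open import Defs
open import Data.Nat using (ℕ; _≤_; _≥_)
open import Data.Integer using (ℤ)
open import Data.List using (List)

open import Data.Nat using (zero; suc; _+_; _*_; _∸_; _<_; z≤n; s≤s; _≤?_; _<?_)
open import Data.Nat.Properties
open import Data.Nat.Divisibility using (_∣_; _∣?_; _∣0; ∣-refl; n∣m*n; ∣m∣n⇒∣m+n; ∣m+n∣m⇒∣n; >⇒∤; divides)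
open import Data.Nat.Induction using (<-rec)
import Data.Integer as ℤ
import Data.Integer.Properties as ℤ
import Data.Integer.Tactic.RingSolver as ℤ-Solver
open import Data.List using ([]; _∷_; _++_; map; length; cartesianProductWith; applyUpTo)
open import Data.List.Properties using (length-++; length-map; length-removeAt′; length-applyUpTo)
open import Data.List.Membership.Propositional using (_∈_; _─_)
open import Data.List.Membership.Propositional.Properties
  using (∈-map⁺; ∈-++⁺ˡ; ∈-++⁺ʳ; ∈-cartesianProductWith⁺; ∈-applyUpTo⁻)
open import Data.List.Membership.DecPropositional ℤ._≟_ using (_∈?_)
open import Data.List.Relation.Binary.Subset.Propositional using (_⊆_)
open import Data.List.Relation.Unary.Any using (here; there)
import Data.List.Relation.Unary.All as All
open import Data.List.Relation.Unary.Unique.Propositional using (Unique; []; _∷_)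
open import Data.List.Relation.Unary.Unique.Propositional.Properties using (applyUpTo⁺₁)
open import Data.Product using (Σ; ∃-syntax; ∃₂; _×_; _,_; proj₁; proj₂)
open import Data.Sum using (_⊎_; inj₁; inj₂; [_,_])
open import Function using (_∘_)
open import Function.Bundles using (_⇔_; mk⇔; Equivalence)
open import Relation.Binary.Definitions using (DecidableEquality)
open import Relation.Nullary using (¬_; yes; no; contradiction)
open import Relation.Unary using (Pred; Decidable)
open import Relation.Binary.PropositionalEquality
  using (_≡_; _≢_; refl; sym; trans; cong; cong₂; subst; subst₂; module ≡-Reasoning)

module _ {a} {A : Set a} where

  ∈-─ : ∀ {x y} {xs : List A} (p : x ∈ xs) → y ∈ xs → y ≢ x → y ∈ xs ─ p
  ∈-─ (here refl) (here refl) y≢x = contradiction refl y≢x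
  ∈-─ (here refl) (there q) _ = q
  ∈-─ (there p) (here refl) _ = here refl
  ∈-─ (there p) (there q) y≢x = there (∈-─ p q y≢x)

  ─-++⁺ˡ : ∀ {x} {xs : List A} ys (p : x ∈ xs) → (xs ++ ys) ─ ∈-++⁺ˡ p ≡ (xs ─ p) ++ ys
  ─-++⁺ˡ ys (here refl) = refl
  ─-++⁺ˡ ys (there p) = cong (_ ∷_) (─-++⁺ˡ ys p)

  ─-++⁺ʳ : ∀ {x} xs {ys : List A} (p : x ∈ ys) → (xs ++ ys) ─ ∈-++⁺ʳ xs p ≡ xs ++ (ys ─ p)
  ─-++⁺ʳ [] p = refl
  ─-++⁺ʳ (x ∷ xs) p = cong (x ∷_) (─-++⁺ʳ xs p)

  Unique⊆⇒length≤ : ∀ {xs ys : List A} → Unique xs → xs ⊆ ys → length xs ≤ length ys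
  Unique⊆⇒length≤ [] _ = z≤n
  Unique⊆⇒length≤ {x ∷ xs} {ys} (x∉xs ∷ u) sub =
    ≤-trans (s≤s (Unique⊆⇒length≤ u (λ q → ∈-─ p (sub (there q)) (All.lookup x∉xs q ∘ sym))))
              (≤-reflexive (sym (length-removeAt′ ys _)))
    where p = sub (here refl)

module _ {a b c} {A : Set a} {B : Set b} {C : Set c} (f : A → B → C) where

  length-cartesianProductWith : ∀ (xs : List A) (ys : List B) →
    length (cartesianProductWith f xs ys) ≡ length xs * length ys
  length-cartesianProductWith [] ys = refl
  length-cartesianProductWith (x ∷ xs) ys = begin
    length (map (f x) ys ++ cartesianProductWith f xs ys)  ≡⟨ length-++ (map (f x) ys) ⟩
    length (map (f x) ys) + length (cartesianProductWith f xs ys)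
      ≡⟨ cong₂ _+_ (length-map (f x) ys) (length-cartesianProductWith xs ys) ⟩
    length ys + length xs * length ys  ∎
    where open ≡-Reasoning

  ∈-cartesianProductWith-twice : ∀ {xs ys x y x' y'} → x ∈ xs → y ∈ ys → x' ∈ xs → y' ∈ ys →
    x ≢ x' → f x y ≡ f x' y' →
    Σ (f x y ∈ cartesianProductWith f xs ys) λ p → f x y ∈ cartesianProductWith f xs ys ─ p
  ∈-cartesianProductWith-twice (here refl) _ (here refl) _ x≢x' _ = contradiction refl x≢x'
  ∈-cartesianProductWith-twice {x ∷ xs} {ys} (here refl) y∈ (there x'∈) y'∈ _ eq =
    ∈-++⁺ˡ p , subst (f x _ ∈_) (sym (─-++⁺ˡ (cartesianProductWith f xs ys) p))
                 (∈-++⁺ʳ (map (f x) ys ─ p) (subst (_∈ cartesianProductWith f xs ys) (sym eq)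
                   (∈-cartesianProductWith⁺ f x'∈ y'∈)))
    where p = ∈-map⁺ (f x) y∈
  ∈-cartesianProductWith-twice {x' ∷ xs} {ys} {x} {y} (there x∈) y∈ (here refl) y'∈ _ eq =
    ∈-++⁺ʳ (map (f x') ys) p , subst (f x y ∈_) (sym (─-++⁺ʳ (map (f x') ys) p))
                                 (∈-++⁺ˡ (subst (_∈ map (f x') ys) (sym eq) (∈-map⁺ (f x') y'∈)))
    where p = ∈-cartesianProductWith⁺ f x∈ y∈
  ∈-cartesianProductWith-twice {x₀ ∷ xs} {ys} {x} {y} (there x∈) y∈ (there x'∈) y'∈ x≢x' eq
    with p , q ← ∈-cartesianProductWith-twice x∈ y∈ x'∈ y'∈ x≢x' eq =
    ∈-++⁺ʳ (map (f x₀) ys) p , subst (f x y ∈_) (sym (─-++⁺ʳ (map (f x₀) ys) p)) (∈-++⁺ʳ (map (f x₀) ys) q)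

  exact-cover⇒injective : DecidableEquality A → DecidableEquality C →
    ∀ {zs xs ys} → Unique zs → zs ⊆ cartesianProductWith f xs ys →
    length (cartesianProductWith f xs ys) ≤ length zs →
    ∀ {x y x' y'} → x ∈ xs → y ∈ ys → x' ∈ xs → y' ∈ ys → f x y ≡ f x' y' → x ≡ x'
  exact-cover⇒injective _≟ᴬ_ _≟ᶜ_ {zs} {xs} {ys} unique cover tight {x} {y} {x'} x∈ y∈ x'∈ y'∈ eq
    with x ≟ᴬ x'
  ... | yes x≡x' = x≡x'
  ... | no x≢x' with p , fxy∈ ← ∈-cartesianProductWith-twice x∈ y∈ x'∈ y'∈ x≢x' eq =
    contradiction (≤-trans tight (Unique⊆⇒length≤ unique cover′))
                  (<⇒≱ (≤-reflexive (sym (length-removeAt′ (cartesianProductWith f xs ys) _))))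
    where
    cover′ : zs ⊆ cartesianProductWith f xs ys ─ p
    cover′ {z} z∈ with z ≟ᶜ f x y
    ... | yes refl = fxy∈
    ... | no z≢fxy = ∈-─ p (cover z∈) z≢fxy

module _ {p} {P : Pred ℕ p} (P? : Decidable P) where

  least-above : ∀ {k y} → k < y → P y →
                ∃[ y' ] (k < y' × P y' × ∀ {z} → k < z → z < y' → ¬ P z)
  least-above {k} {y} k<y Py with search (suc y)
    where
    search : ∀ y → (∀ {z} → k < z → z < y → ¬ P z) ⊎
                   ∃[ y' ] (k < y' × P y' × ∀ {z} → k < z → z < y' → ¬ P z)
    search zero = inj₁ λ _ ()
    search (suc y) with search y
    ... | inj₂ least = inj₂ least
    ... | inj₁ none with k <? y | P? y
    ...   | yes k<y | yes Py = inj₂ (y , k<y , Py , none)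
    ...   | no k≮y | _ = inj₁ λ k<z z≤y _ → k≮y (<-≤-trans k<z (≤-pred z≤y))
    ...   | _ | no ¬Py = inj₁ λ k<z z≤y →
              [ none k<z , (λ { refl → ¬Py }) ] (m<1+n⇒m<n∨m≡n z≤y)
  ... | inj₁ none = contradiction Py (none k<y ≤-refl)
  ... | inj₂ least = least

module Tiling
  (n : ℕ) (A B : ℕ → Set) (A? : Decidable A)
  (represent : ∀ {c} → 1 ≤ c → c ≤ n → ∃₂ λ a b → A a × B b × a + b ≡ c)
  (sum-bounds : ∀ {a b} → A a → B b → 1 ≤ a + b × a + b ≤ n)
  (decomposition-unique : ∀ {a b a' b'} → A a → B b → A a' → B b' → a + b ≡ a' + b' → a ≡ a')
  (0∈B : B 0)
  where

  A-positive : ∀ {a} → A a → 1 ≤ a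
  A-positive {a} a∈A = subst (1 ≤_) (+-identityʳ a) (proj₁ (sum-bounds a∈A 0∈B))

  A-bounded : ∀ {a} → A a → a ≤ n
  A-bounded {a} a∈A = subst (_≤ n) (+-identityʳ a) (proj₂ (sum-bounds a∈A 0∈B))

  B-unique : ∀ {a b a' b'} → A a → B b → A a' → B b' → a + b ≡ a' + b' → b ≡ b'
  B-unique {a} {b} {a'} {b'} a∈A b∈B a'∈A b'∈B eq =
    +-cancelˡ-≡ a b b' (trans eq (cong (_+ b') (sym (decomposition-unique a∈A b∈B a'∈A b'∈B eq))))

  A+b∈A⇒b≡0 : ∀ {a b} → A a → B b → A (a + b) → b ≡ 0
  A+b∈A⇒b≡0 {a} {b} a∈A b∈B ab∈A = B-unique a∈A b∈B ab∈A 0∈B (sym (+-identityʳ (a + b)))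

  represent-∉A : ∀ {c} → 1 ≤ c → c ≤ n → ¬ A c → ∃₂ λ a b → A a × B (suc b) × a + suc b ≡ c
  represent-∉A 1≤c c≤n c∉A with represent 1≤c c≤n
  ... | a , zero , a∈A , _ , eq = contradiction (subst A (trans (sym (+-identityʳ a)) eq) a∈A) c∉A
  ... | a , suc b , a∈A , b∈B , eq = a , b , a∈A , b∈B , eq

  1∈A : 1 ≤ n → A 1
  1∈A 1≤n with represent ≤-refl 1≤n
  ... | a , b , a∈A , _ , eq = subst A (≤-antisym (subst (a ≤_) eq (m≤m+n a b)) (A-positive a∈A)) a∈A

  record Gap (x y : ℕ) : Set where
    field
      start∈A    : A x
      end∈A      : A y
      start<end  : x < y
      successor∉A : ¬ A (suc x)
      interior∉A : ∀ {z} → x < z → z < y → ¬ A z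

  gap-nonempty : ∀ {x y} → Gap x y → suc x < y
  gap-nonempty gap = ≤∧≢⇒< start<end λ { refl → successor∉A end∈A }
    where open Gap gap

  FirstGap : ℕ → ℕ → Set
  FirstGap x y = Gap x y × (∀ {x' y'} → Gap x' y' → x ≤ x')

  initial-segment : ∀ {m y} → FirstGap m y → ∀ {z} → 1 ≤ z → z ≤ m → A z
  initial-segment {m} (gap , minimal) {suc k} _ = segment k
    where
    segment : ∀ k → suc k ≤ m → A (suc k)
    segment zero 1≤m = 1∈A (≤-trans 1≤m (A-bounded (Gap.start∈A gap)))
    segment (suc k) k+2≤m with A? (suc (suc k))
    ... | yes k+2∈A = k+2∈A
    ... | no k+2∉A with least-above A? k+2≤m (Gap.start∈A gap)
    ...   | y , k+1<y , y∈A , interior = contradiction (minimal gap′) (<⇒≱ k+2≤m)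
      where
      gap′ : Gap (suc k) y
      gap′ = record
        { start∈A = segment k (<⇒≤ k+2≤m) ; end∈A = y∈A ; start<end = k+1<y
        ; successor∉A = k+2∉A ; interior∉A = interior }

  module FirstSegment
    (m : ℕ) (segment : ∀ {z} → 1 ≤ z → z ≤ m → A z) (m+1∉A : ¬ A (suc m)) (m<n : m < n)
    where

    1≤m : 1 ≤ m
    1≤m = n≢0⇒n>0 λ { refl → m+1∉A (1∈A m<n) }

    m∈A : A m
    m∈A = segment 1≤m ≤-refl

    m∈B : B m
    m∈B with represent-∉A (s≤s z≤n) m<n m+1∉A
    ... | zero , _ , a∈A , _ , _ = contradiction (A-positive a∈A) λ ()
    ... | suc zero , b , _ , b∈B , eq = subst B (suc-injective eq) b∈B
    ... | suc (suc a) , b , _ , b∈B , eq =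
      contradiction (A+b∈A⇒b≡0 (segment ≤-refl 1≤m) b∈B (segment (s≤s z≤n) b+2≤m)) λ ()
      where
      b+2≤m : suc (suc b) ≤ m
      b+2≤m = subst (suc (suc b) ≤_) (suc-injective eq) (s≤s (m≤n+m (suc b) a))

    BMultipleAt : ℕ → Set
    BMultipleAt c = ∀ {a b} → A a → B b → a + b ≡ c → m ∣ b

    NoBoundaryAt : ℕ → Set
    NoBoundaryAt c = ¬ m ∣ c → suc c ≤ n → A c ⇔ A (suc c)

    lift-representation : ∀ {j} → BMultipleAt j → (∀ {i} → i < j → NoBoundaryAt i) →
      ¬ m ∣ j → suc j ≤ n → ¬ A j → ∃₂ λ a b → A (suc a) × B (suc b) × m ∣ suc b × a + suc b ≡ j
    lift-representation {j} multiple no-boundary m∤j j<n j∉A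
      with represent-∉A (n≢0⇒n>0 λ { refl → m∤j (m ∣0) }) (<⇒≤ j<n) j∉A
    ... | a , b , a∈A , b∈B , eq = a , b , a+1∈A , b∈B , m∣b , eq
      where
      m∣b : m ∣ suc b
      m∣b = multiple a∈A b∈B eq
      a<j : a < j
      a<j = subst (a <_) eq (m<m+n a (s≤s z≤n))
      m∤a : ¬ m ∣ a
      m∤a m∣a = m∤j (subst (m ∣_) eq (∣m∣n⇒∣m+n m∣a m∣b))
      a+1∈A : A (suc a)
      a+1∈A = Equivalence.to (no-boundary a<j m∤a (<-trans a<j j<n)) a∈A

    B-multiple-step : ∀ {c} → (∀ {j} → j < c → BMultipleAt j) → (∀ {j} → j < c → NoBoundaryAt j) →
      BMultipleAt c
    B-multiple-step _ _ {b = zero} _ _ _ = m ∣0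
    B-multiple-step _ _ {zero} {suc b} a∈A _ _ = contradiction (A-positive a∈A) λ ()
    B-multiple-step multiple< no-boundary< {suc a} {suc b} a+1∈A b∈B refl with m ∣? a
    ... | no m∤a = multiple< ≤-refl a∈A b∈B refl
      where
      a∈A : A a
      a∈A = Equivalence.from (no-boundary< (s≤s (m≤m+n a (suc b))) m∤a (A-bounded a+1∈A)) a+1∈A
    ... | yes m∣a with m ∣? (a + suc b)
    ...   | yes m∣c-1 = ∣m+n∣m⇒∣n m∣c-1 m∣a
    ...   | no m∤c-1
      with lift-representation (multiple< ≤-refl) (λ i<c-1 → no-boundary< (<-trans i<c-1 ≤-refl))
             m∤c-1 c≤n c-1∉A
      where
      c≤n : suc a + suc b ≤ n
      c≤n = proj₂ (sum-bounds a+1∈A b∈B)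
      c-1∉A : ¬ A (a + suc b)
      c-1∉A c-1∈A = contradiction
        (A+b∈A⇒b≡0 a+1∈A b∈B (Equivalence.to (no-boundary< ≤-refl m∤c-1 c≤n) c-1∈A)) λ ()
    ...     | a₁ , b₁ , a₁+1∈A , b₁∈B , m∣b₁ , eq₁ =
      subst (m ∣_) (B-unique a₁+1∈A b₁∈B a+1∈A b∈B (cong suc eq₁)) m∣b₁

    no-boundary-step : ∀ {c} → (∀ {j} → j ≤ c → BMultipleAt j) → (∀ {j} → j < c → NoBoundaryAt j) →
      NoBoundaryAt c
    no-boundary-step {c} multiple≤ no-boundary< m∤c c<n = mk⇔ up down
      where
      down : A (suc c) → A c
      down c+1∈A with A? c
      ... | yes c∈A = c∈A
      ... | no c∉A with lift-representation (multiple≤ ≤-refl) no-boundary< m∤c c<n c∉A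
      ...   | a , b , a+1∈A , b∈B , _ , eq =
        contradiction (A+b∈A⇒b≡0 a+1∈A b∈B (subst A (sym (cong suc eq)) c+1∈A)) λ ()

      up : A c → A (suc c)
      up c∈A with A? (suc c)
      ... | yes c+1∈A = c+1∈A
      ... | no c+1∉A with represent-∉A (s≤s z≤n) c<n c+1∉A
      ...   | zero , _ , a∈A , _ , _ = contradiction (A-positive a∈A) λ ()
      ...   | suc a , b , a+1∈A , b∈B , eq with m ∣? a
      ...     | yes m∣a = contradiction (subst (m ∣_) c-1≡ (∣m∣n⇒∣m+n m∣a (b-multiple a c-1≡))) m∤c
        where
        c-1≡ : a + suc b ≡ c
        c-1≡ = suc-injective eq
        b-multiple : ∀ a → a + suc b ≡ c → m ∣ suc b
        b-multiple zero refl =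
          contradiction (subst (m ∣_) (decomposition-unique m∈A b∈B c∈A m∈B (+-comm m c)) ∣-refl) m∤c
        b-multiple (suc a) refl = multiple≤ (s≤s (m≤n+m (suc b) a)) (segment ≤-refl 1≤m) b∈B refl
      ...     | no m∤a =
        contradiction (A+b∈A⇒b≡0 a∈A b∈B (subst A (sym (suc-injective eq)) c∈A)) λ ()
        where
        a∈A : A a
        a∈A = Equivalence.from (no-boundary< (subst (a <_) (suc-injective eq) (m<m+n a (s≤s z≤n))) m∤a
                                  (A-bounded a+1∈A)) a+1∈A

    Aligned : ℕ → Set
    Aligned c = BMultipleAt c × NoBoundaryAt c

    aligned : ∀ c → Aligned c
    aligned = <-rec Aligned λ c aligned< → step aligned<
      where
      step : ∀ {c} → (∀ {j} → j < c → Aligned j) → Aligned c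
      step {c} aligned< = multiple , no-boundary-step multiple≤ (λ j<c → proj₂ (aligned< j<c))
        where
        multiple : BMultipleAt c
        multiple = B-multiple-step (λ j<c → proj₁ (aligned< j<c)) (λ j<c → proj₂ (aligned< j<c))
        multiple≤ : ∀ {j} → j ≤ c → BMultipleAt j
        multiple≤ j≤c with m≤n⇒m<n∨m≡n j≤c
        ... | inj₁ j<c = proj₁ (aligned< j<c)
        ... | inj₂ refl = multiple

    B-multiple : ∀ {a b} → A a → B b → m ∣ b
    B-multiple a∈A b∈B = proj₁ (aligned _) a∈A b∈B refl

    no-boundary : ∀ {c} → ¬ m ∣ c → suc c ≤ n → A c ⇔ A (suc c)
    no-boundary = proj₂ (aligned _)

    segment-end-multiple : ∀ {x} → A x → ¬ A (suc x) → suc x ≤ n → m ∣ x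
    segment-end-multiple {x} x∈A x+1∉A x<n with m ∣? x
    ... | yes m∣x = m∣x
    ... | no m∤x = contradiction (Equivalence.to (no-boundary m∤x x<n) x∈A) x+1∉A

    segment-start-multiple : ∀ {y} → A (suc y) → ¬ A y → m ∣ y
    segment-start-multiple {y} y+1∈A y∉A with m ∣? y
    ... | yes m∣y = m∣y
    ... | no m∤y = contradiction (Equivalence.from (no-boundary m∤y (A-bounded y+1∈A)) y+1∈A) y∉A

    block-start : ∀ {w} r → m ∣ w → 1 ≤ r → r ≤ m → A (w + r) → A (suc w)
    block-start {w} (suc zero) _ _ _ = subst A (+-comm w 1)
    block-start {w} (suc (suc r)) m∣w _ r+2≤m w+r+2∈A =
      block-start (suc r) m∣w (s≤s z≤n) (<⇒≤ r+2≤m)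
        (Equivalence.from (no-boundary m∤w+r+1 (A-bounded w+r+2∈A′)) w+r+2∈A′)
      where
      w+r+2∈A′ : A (suc (w + suc r))
      w+r+2∈A′ = subst A (+-suc w (suc r)) w+r+2∈A
      m∤w+r+1 : ¬ m ∣ (w + suc r)
      m∤w+r+1 m∣w+r+1 = >⇒∤ r+2≤m (∣m+n∣m⇒∣n m∣w+r+1 m∣w)

    segment-end-block : ∀ {x} → A x → ¬ A (suc x) → suc x ≤ n → ∃[ w ] x ≡ w + m × A (suc w)
    segment-end-block {x} x∈A x+1∉A x<n with segment-end-multiple x∈A x+1∉A x<n
    ... | divides zero refl = contradiction (A-positive x∈A) λ ()
    ... | divides (suc q) refl =
      q * m , +-comm m (q * m) , block-start m (n∣m*n q) 1≤m ≤-refl (subst A (+-comm m (q * m)) x∈A)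

    gap-length-multiple : ∀ {x D} → Gap x (suc (x + D)) → m ∣ D
    gap-length-multiple {x} {D} gap = ∣m+n∣m⇒∣n m∣x+D m∣x
      where
      open Gap gap
      m∣x : m ∣ x
      m∣x = segment-end-multiple start∈A successor∉A (≤-trans start<end (A-bounded end∈A))
      m∣x+D : m ∣ x + D
      m∣x+D = segment-start-multiple end∈A (interior∉A (≤-pred (gap-nonempty gap)) ≤-refl)

    multiple∈B : ∀ {E} → m ∣ E → m ≤ E → suc E ≤ n → (∀ {z} → m < z → z ≤ suc E → ¬ A z) → B E
    multiple∈B {E} m∣E m≤E E<n none with represent-∉A (s≤s z≤n) E<n (none (s≤s m≤E) ≤-refl)
    ... | zero , _ , a∈A , _ , _ = contradiction (A-positive a∈A) λ ()
    ... | suc zero , b , _ , b∈B , eq = subst B (suc-injective eq) b∈B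
    ... | suc (suc a) , b , a∈A , b∈B , eq = contradiction m∣a+1 (>⇒∤ a+1<m)
      where
      m∣a+1 : m ∣ suc a
      m∣a+1 = ∣m+n∣m⇒∣n (subst (m ∣_) (trans (sym (suc-injective eq)) (+-comm (suc a) (suc b))) m∣E)
                         (B-multiple a∈A b∈B)
      a+1<m : suc a < m
      a+1<m = ≮⇒≥ λ m<a+2 → none m<a+2 (subst (suc (suc a) ≤_) eq (m≤m+n (suc (suc a)) (suc b))) a∈A

    first-gap-length≤ : ∀ {G x D} → Gap m (suc (m + G)) → Gap x (suc (x + D)) → G ≤ D
    first-gap-length≤ {G} {x} {D} first gap with G ≤? D
    ... | yes G≤D = G≤D
    ... | no G≰D with segment-end-block (Gap.start∈A gap) (Gap.successor∉A gap) x<n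
      where
      x<n : suc x ≤ n
      x<n = ≤-trans (Gap.start<end gap) (A-bounded (Gap.end∈A gap))
    ...   | w , refl , w+1∈A = contradiction (A+b∈A⇒b≡0 w+1∈A E∈B y∈A) E≢0
      where
      E = D + m
      E<m+G : E < m + G
      E<m+G = subst (E <_) (+-comm G m) (+-monoˡ-< m (≰⇒> G≰D))
      E∈B : B E
      E∈B = multiple∈B (∣m∣n⇒∣m+n (gap-length-multiple gap) ∣-refl) (m≤n+m m D)
        (≤-trans E<m+G (<⇒≤ (A-bounded (Gap.end∈A first))))
        (λ m<z z≤E+1 → Gap.interior∉A first m<z (s≤s (≤-trans z≤E+1 E<m+G)))
      y∈A : A (suc w + E)
      y∈A = subst A (cong suc (begin
        w + m + D   ≡⟨ +-assoc w m D ⟩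
        w + (m + D) ≡⟨ cong (w +_) (+-comm m D) ⟩
        w + E       ∎)) (Gap.end∈A gap)
        where open ≡-Reasoning
      E≢0 : E ≢ 0
      E≢0 E≡0 = contradiction (subst (1 ≤_) E≡0 (≤-trans 1≤m (m≤n+m m D))) λ ()

  first-gap-shortest : ∀ {x₁ y₁ x y} → FirstGap x₁ y₁ → Gap x y → y₁ ∸ suc x₁ ≤ y ∸ suc x
  first-gap-shortest first@(gap₁ , _) gap =
    FirstSegment.first-gap-length≤ _ (initial-segment first) (Gap.successor∉A gap₁)
      (≤-trans (Gap.start<end gap₁) (A-bounded (Gap.end∈A gap₁))) (normalise gap₁) (normalise gap)
    where
    normalise : ∀ {x y} → Gap x y → Gap x (suc (x + (y ∸ suc x)))
    normalise {x} gap = subst (Gap x) (sym (m+[n∸m]≡n (Gap.start<end gap))) gap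

riftSize-+ : ∀ a d → riftSize (ℤ.+ a) (ℤ.+ (suc a + d)) ≡ d
riftSize-+ a d = cong ℤ.∣_∣ (cancel (ℤ.+ a) (ℤ.+ d))
  where
  cancel : ∀ i j → ℤ.1ℤ ℤ.+ (i ℤ.+ j) ℤ.- i ℤ.- ℤ.1ℤ ≡ j
  cancel = ℤ-Solver.solve-∀

module IntegerTiling
  (A B : List ℤ) (n : ℕ)
  (cover : ∀ z → InInterval n z ⇔ (∃[ a ] ∃[ b ] (a ∈ A × b ∈ B × a ℤ.+ b ≡ z)))
  (size : n ≡ length A * length B)
  (0∈B : ℤ.0ℤ ∈ B) (B≥0 : ∀ b → b ∈ B → ℤ.0ℤ ℤ.≤ b)
  where

  sum∈[n] : ∀ {a b} → a ∈ A → b ∈ B → InInterval n (a ℤ.+ b)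
  sum∈[n] {a} {b} a∈A b∈B = Equivalence.from (cover (a ℤ.+ b)) (a , b , a∈A , b∈B , refl)

  A-natural : ∀ {a} → a ∈ A → ℤ.+ ℤ.∣ a ∣ ≡ a
  A-natural {a} a∈A = ℤ.0≤i⇒+∣i∣≡i
    (ℤ.≤-trans (ℤ.+≤+ z≤n) (subst (ℤ.1ℤ ℤ.≤_) (ℤ.+-identityʳ a) (proj₁ (sum∈[n] a∈A 0∈B))))

  B-natural : ∀ {b} → b ∈ B → ℤ.+ ℤ.∣ b ∣ ≡ b
  B-natural b∈B = ℤ.0≤i⇒+∣i∣≡i (B≥0 _ b∈B)

  interval : List ℤ
  interval = applyUpTo (λ i → ℤ.+ suc i) n

  decomposition-unique : ∀ {a b a' b'} → a ∈ A → b ∈ B → a' ∈ A → b' ∈ B → a ℤ.+ b ≡ a' ℤ.+ b' → a ≡ a'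
  decomposition-unique = exact-cover⇒injective ℤ._+_ ℤ._≟_ ℤ._≟_ interval-unique interval⊆sums
    (≤-reflexive (trans (length-cartesianProductWith ℤ._+_ A B)
                        (trans (sym size) (sym (length-applyUpTo _ n)))))
    where
    interval-unique : Unique interval
    interval-unique = applyUpTo⁺₁ _ n λ i<j _ eq → <⇒≢ i<j (suc-injective (ℤ.+-injective eq))
    interval⊆sums : interval ⊆ cartesianProductWith ℤ._+_ A B
    interval⊆sums z∈ with i , i<n , refl ← ∈-applyUpTo⁻ _ z∈
      with a , b , a∈A , b∈B , eq ← Equivalence.to (cover _) (ℤ.+≤+ (s≤s z≤n) , ℤ.+≤+ i<n) =
      subst (_∈ _) eq (∈-cartesianProductWith⁺ ℤ._+_ a∈A b∈B)

  A⁺ B⁺ : ℕ → Set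
  A⁺ k = ℤ.+ k ∈ A
  B⁺ k = ℤ.+ k ∈ B

  represent : ∀ {c} → 1 ≤ c → c ≤ n → ∃₂ λ a b → A⁺ a × B⁺ b × a + b ≡ c
  represent 1≤c c≤n with a , b , a∈A , b∈B , eq ← Equivalence.to (cover _) (ℤ.+≤+ 1≤c , ℤ.+≤+ c≤n) =
    ℤ.∣ a ∣ , ℤ.∣ b ∣ , subst (_∈ A) (sym (A-natural a∈A)) a∈A , subst (_∈ B) (sym (B-natural b∈B)) b∈B ,
    ℤ.+-injective (trans (cong₂ ℤ._+_ (A-natural a∈A) (B-natural b∈B)) eq)

  sum-bounds : ∀ {a b} → A⁺ a → B⁺ b → 1 ≤ a + b × a + b ≤ n
  sum-bounds a∈A b∈B with lower , upper ← sum∈[n] a∈A b∈B = ℤ.drop‿+≤+ lower , ℤ.drop‿+≤+ upper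

  open Tiling n A⁺ B⁺ (λ k → ℤ.+ k ∈? A) represent sum-bounds
    (λ a∈A b∈B a'∈A b'∈B eq → ℤ.+-injective (decomposition-unique a∈A b∈B a'∈A b'∈B (cong ℤ.+_ eq)))
    0∈B public

  rift⁺⇒gap : ∀ {x y} → Rift A (ℤ.+ x) (ℤ.+ y) → Gap x y
  rift⁺⇒gap {x} (x∈A , y∈A , x<y , x+1∉A , interior) = record
    { start∈A = x∈A ; end∈A = y∈A ; start<end = ℤ.drop‿+<+ x<y
    ; successor∉A = x+1∉A ∘ subst (_∈ A) (cong ℤ.+_ (+-comm 1 x))
    ; interior∉A = λ x<z z<y z∈A → interior _ z∈A (ℤ.+<+ x<z , ℤ.+<+ z<y) }

  rift⇒gap : ∀ {x y} → Rift A x y → Gap ℤ.∣ x ∣ ℤ.∣ y ∣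
  rift⇒gap rift@(x∈A , y∈A , _) =
    rift⁺⇒gap (subst₂ (Rift A) (sym (A-natural x∈A)) (sym (A-natural y∈A)) rift)

  gap⇒rift : ∀ {x y} → Gap x y → Rift A (ℤ.+ x) (ℤ.+ y)
  gap⇒rift {x} gap =
    start∈A , end∈A , ℤ.+<+ start<end , successor∉A ∘ subst (_∈ A) (cong ℤ.+_ (+-comm x 1)) ,
    λ z z∈A (x<z , z<y) → interior∉A (ℤ.drop‿+<+ (subst (ℤ.+ x ℤ.<_) (sym (A-natural z∈A)) x<z))
                                     (ℤ.drop‿+<+ (subst (ℤ._< _) (sym (A-natural z∈A)) z<y))
                                     (subst (_∈ A) (sym (A-natural z∈A)) z∈A)
    where open Gap gap

  firstRift⇒firstGap : ∀ {x y} → FirstRift A x y → FirstGap ℤ.∣ x ∣ ℤ.∣ y ∣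
  firstRift⇒firstGap (rift@(x∈A , _) , first) =
    rift⇒gap rift , λ gap → ℤ.drop‿+≤+ (subst (ℤ._≤ _) (sym (A-natural x∈A)) (first _ _ (gap⇒rift gap)))

  riftSize-gap : ∀ {x y} → Rift A x y → riftSize x y ≡ ℤ.∣ y ∣ ∸ suc ℤ.∣ x ∣
  riftSize-gap {x} {y} rift@(x∈A , y∈A , _) = begin
    riftSize x y
      ≡⟨ cong₂ riftSize (sym (A-natural x∈A)) (sym (A-natural y∈A)) ⟩
    riftSize (ℤ.+ ℤ.∣ x ∣) (ℤ.+ ℤ.∣ y ∣)
      ≡⟨ cong (riftSize (ℤ.+ ℤ.∣ x ∣) ∘ ℤ.+_) (sym (m+[n∸m]≡n x<y)) ⟩
    riftSize (ℤ.+ ℤ.∣ x ∣) (ℤ.+ (suc ℤ.∣ x ∣ + d))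
      ≡⟨ riftSize-+ ℤ.∣ x ∣ d ⟩
    d ∎
    where
    open ≡-Reasoning
    x<y : ℤ.∣ x ∣ < ℤ.∣ y ∣
    x<y = Gap.start<end (rift⇒gap rift)
    d = ℤ.∣ y ∣ ∸ suc ℤ.∣ x ∣

corollary4 : (α n : ℕ) → α ≥ 1 → n ≥ 1 → (A B : List ℤ) → InT α n A B →
    (x₁ y₁ : ℤ) → FirstRift A x₁ y₁ →
    (x y : ℤ) → Rift A x y →
    riftSize x₁ y₁ ≤ riftSize x y
corollary4 α n _ _ A B (_ , _ , cover , size , _ , 0∈B , B≥0) x₁ y₁ first x y rift =
  subst₂ _≤_ (sym (riftSize-gap (proj₁ first))) (sym (riftSize-gap rift))
    (first-gap-shortest (firstRift⇒firstGap first) (rift⇒gap rift))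
  where open IntegerTiling A B n cover size 0∈B B≥0
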